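{- Let $\Gamma$ be a context, $t$ a term and $A$ a type of $\mathsf{RSLR}$ with $\Gamma\vdash t:A$. If $t\rightarrow t_1,\ldots,t_j$, then $\Gamma\vdash t_i:A$ for every $i\in\{1,\ldots,j\}$.
   Context: $\mathsf{RSLR}$ is the following typed lambda calculus. Types: $A::=\mathbf{N}\mid \square A\rightarrow A\mid \blacksquare A\rightarrow A$ (arrow types written $aA\rightarrow B$, aspect $a\in\{\square,\blacksquare\}$); $H$ ranges over types other than $\mathbf{N}$. Aspects are ordered by $\square<:\square$, $\square<:\blacksquare$, $\blacksquare<:\blacksquare$; subtyping is the least reflexive transitive relation with $aA\rightarrow C<:bB\rightarrow D$ when $B<:A$, $C<:D$, $b<:a$. A type is $\square$-free if $\square$ does not occur in it. Terms: $t::=x\mid c\mid ts\mid \lambda x:aA.t\mid \mathtt{case}_A\,t\ \mathtt{zero}\ s\ \mathtt{even}\ r\ \mathtt{odd}\ q\mid \mathtt{recursion}_A\,t\,s\,r$, constants $c::=n\mid S_0\mid S_1\mid P\mid\mathtt{rand}$ (numerals $n$), modulo $\alpha$-conversion; $t[x:=s]$ is capture-avoiding substitution. Constant types: $n,\mathtt{rand}:\mathbf{N}$; $S_0,S_1,P:\blacksquare\mathbf{N}\rightarrow\mathbf{N}$. Contexts are finite sets of $x:aA$ with distinct variables; $\Gamma,\Delta$ is disjoint union, written $\Gamma;\Delta$ when all types in $\Gamma$ are $\mathbf{N}$; $\Gamma<:a$ means all aspects in $\Gamma$ are $<:a$. Typing rules: $\Gamma\vdash x:A$ if $x:aA\in\Gamma$;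 from $\Gamma\vdash t:A$, $A<:B$ infer $\Gamma\vdash t:B$; from $\Gamma,x:aA\vdash t:B$ infer $\Gamma\vdash\lambda x:aA.t:aA\rightarrow B$; $\Gamma\vdash c:\mathrm{type}(c)$; from $\Gamma;\Delta_1\vdash t:\mathbf{N}$, $\Gamma;\Delta_2\vdash s:A$, $\Gamma;\Delta_3\vdash r:A$, $\Gamma;\Delta_4\vdash q:A$, $A$ $\square$-free, infer $\Gamma;\Delta_1,\Delta_2,\Delta_3,\Delta_4\vdash\mathtt{case}_A\,t\ \mathtt{zero}\ s\ \mathtt{even}\ r\ \mathtt{odd}\ q:A$; from $\Gamma_1;\Delta_1\vdash t:\mathbf{N}$, $\Gamma_1,\Gamma_2;\Delta_2\vdash s:A$, $\Gamma_1,\Gamma_2;\emptyset\vdash r:\square\mathbf{N}\rightarrow\blacksquare A\rightarrow A$, $\Gamma_1,\Delta_1<:\square$, $A$ $\square$-free, infer $\Gamma_1,\Gamma_2;\Delta_1,\Delta_2\vdash\mathtt{recursion}_A\,t\,s\,r:A$; from $\Gamma;\Delta_1\vdash t:aA\rightarrow B$, $\Gamma;\Delta_2\vdash s:A$, $\Gamma,\Delta_2<:a$ infer $\Gamma;\Delta_1,\Delta_2\vdash ts:B$. One-step reduction $t\rightarrow t_1,\ldots,t_n$ ($n\in\{1,2\}$) relates a term to a sequence of terms; axioms ($n$ numerals): $\mathtt{case}_A\,0\ \mathtt{zero}\ t\ \mathtt{even}\ s\ \mathtt{odd}\ r\rightarrow t$; $\mathtt{case}_A\,(S_0n)\ \mathtt{zero}\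 t\ \mathtt{even}\ s\ \mathtt{odd}\ r\rightarrow s$; $\mathtt{case}_A\,(S_1n)\ \mathtt{zero}\ t\ \mathtt{even}\ s\ \mathtt{odd}\ r\rightarrow r$; $\mathtt{recursion}_A\,0\,g\,f\rightarrow g$; $\mathtt{recursion}_A\,n\,g\,f\rightarrow f\,n\,(\mathtt{recursion}_A\lfloor n/2\rfloor g f)$ ($n\ge1$); $S_0n\rightarrow2n$; $S_1n\rightarrow2n+1$; $P0\rightarrow0$; $Pn\rightarrow\lfloor n/2\rfloor$; $(\lambda x:a\mathbf{N}.t)n\rightarrow t[x:=n]$; $(\lambda x:aH.t)s\rightarrow t[x:=s]$; $(\lambda x:aA.t)sr\rightarrow(\lambda x:aA.tr)s$; $\mathtt{rand}\rightarrow0,1$. It is closed under all term contexts except the second and third arguments of $\mathtt{recursion}$: if $t\rightarrow t_1,\ldots,t_n$ then $C[t]\rightarrow C[t_1],\ldots,C[t_n]$. -}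

module Defs where

open import Data.Nat using (ℕ; zero; suc; _+_; _*_; ⌊_/2⌋)
open import Data.Fin using (Fin; zero; suc)
open import Data.Vec using (Vec; []; _∷_; lookup)
open import Data.Maybe using (Maybe; just; nothing)
open import Data.Product using (_×_; _,_)
open import Data.List using (List; []; _∷_; [_]; map)
open import Relation.Binary.PropositionalEquality using (_≡_)

data Asp : Set where
  □ ■ : Asp

data _<:a_ : Asp → Asp → Set where
  □□ : □ <:a □
  □■ : □ <:a ■
  ■■ : ■ <:a ■

data Ty : Set where
  𝐍   : Ty
  arr : Asp → Ty → Ty → Ty      -- arr a A B  is  aA → B

data _<:_ : Ty → Ty → Set where
  <:-refl  : ∀ {A} → A <: A
  <:-trans : ∀ {A B C} → A <: B → B <: C → A <: C
  <:-arr   : ∀ {a b A B C D} → B <: A → C <: D → b <:a a →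
             arr a A C <: arr b B D

data BoxFree : Ty → Set where
  bf-N   : BoxFree 𝐍
  bf-arr : ∀ {A B} → BoxFree A → BoxFree B → BoxFree (arr ■ A B)

-- Terms (well-scoped de Bruijn; α-conversion is built in)

data Const : Set where
  num  : ℕ → Const
  S₀ S₁ P rand : Const

typeOf : Const → Ty
typeOf (num _) = 𝐍
typeOf rand    = 𝐍
typeOf S₀      = arr ■ 𝐍 𝐍
typeOf S₁      = arr ■ 𝐍 𝐍
typeOf P       = arr ■ 𝐍 𝐍

data Tm (n : ℕ) : Set where
  var       : Fin n → Tm n
  con       : Const → Tm n
  app       : Tm n → Tm n → Tm n
  lam       : Asp → Ty → Tm (suc n) → Tm n
  case      : Ty → Tm n → Tm n → Tm n → Tm n → Tm n   -- case_A t zero s even r odd q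
  recursion : Ty → Tm n → Tm n → Tm n → Tm n

numeral : ∀ {n} → ℕ → Tm n
numeral k = con (num k)

ext : ∀ {n m} → (Fin n → Fin m) → Fin (suc n) → Fin (suc m)
ext ρ zero    = zero
ext ρ (suc i) = suc (ρ i)

rename : ∀ {n m} → (Fin n → Fin m) → Tm n → Tm m
rename ρ (var i)             = var (ρ i)
rename ρ (con c)             = con c
rename ρ (app t s)           = app (rename ρ t) (rename ρ s)
rename ρ (lam a A t)         = lam a A (rename (ext ρ) t)
rename ρ (case A t s r q)    = case A (rename ρ t) (rename ρ s) (rename ρ r) (rename ρ q)
rename ρ (recursion A t s r) = recursion A (rename ρ t) (rename ρ s) (rename ρ r)

exts : ∀ {n m} → (Fin n → Tm m) → Fin (suc n) → Tm (suc m)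
exts σ zero    = var zero
exts σ (suc i) = rename suc (σ i)

subst : ∀ {n m} → (Fin n → Tm m) → Tm n → Tm m
subst σ (var i)             = σ i
subst σ (con c)             = con c
subst σ (app t s)           = app (subst σ t) (subst σ s)
subst σ (lam a A t)         = lam a A (subst (exts σ) t)
subst σ (case A t s r q)    = case A (subst σ t) (subst σ s) (subst σ r) (subst σ q)
subst σ (recursion A t s r) = recursion A (subst σ t) (subst σ s) (subst σ r)

_[0≔_] : ∀ {n} → Tm (suc n) → Tm n → Tm n
t [0≔ s ] = subst σ t
  where
  σ : _ → _
  σ zero    = s
  σ (suc i) = var i

weaken : ∀ {n} → Tm n → Tm (suc n)
weaken = rename suc

-- Contexts: finite partial maps from the variables in scope to
-- (aspect , type).  'nothing' = variable not in the context.

Ctx : ℕ → Set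
Ctx n = Vec (Maybe (Asp × Ty)) n

data _≔_⊎_ : ∀ {n} → Ctx n → Ctx n → Ctx n → Set where
  []    : [] ≔ [] ⊎ []
  none  : ∀ {n} {Θ Γ Δ : Ctx n} → Θ ≔ Γ ⊎ Δ →
          (nothing ∷ Θ) ≔ (nothing ∷ Γ) ⊎ (nothing ∷ Δ)
  left  : ∀ {n} {Θ Γ Δ : Ctx n} {p} → Θ ≔ Γ ⊎ Δ →
          (just p ∷ Θ) ≔ (just p ∷ Γ) ⊎ (nothing ∷ Δ)
  right : ∀ {n} {Θ Γ Δ : Ctx n} {p} → Θ ≔ Γ ⊎ Δ →
          (just p ∷ Θ) ≔ (nothing ∷ Γ) ⊎ (just p ∷ Δ)

data NatEntry : Maybe (Asp × Ty) → Set where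
  ne-nothing : NatEntry nothing
  ne-just    : ∀ {a} → NatEntry (just (a , 𝐍))

data AllNat : ∀ {n} → Ctx n → Set where
  []  : AllNat []
  _∷_ : ∀ {n} {e} {Γ : Ctx n} → NatEntry e → AllNat Γ → AllNat (e ∷ Γ)

data AspEntry (a : Asp) : Maybe (Asp × Ty) → Set where
  ae-nothing : AspEntry a nothing
  ae-just    : ∀ {b A} → b <:a a → AspEntry a (just (b , A))

data CtxAsp (a : Asp) : ∀ {n} → Ctx n → Set where
  []  : CtxAsp a []
  _∷_ : ∀ {n} {e} {Γ : Ctx n} → AspEntry a e → CtxAsp a Γ → CtxAsp a (e ∷ Γ)

infix 4 _⊢_∶_
data _⊢_∶_ {n : ℕ} : Ctx n → Tm n → Ty → Set where
  ty-var : ∀ {Γ x a A} → lookup Γ x ≡ just (a , A) → Γ ⊢ var x ∶ A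
  ty-sub : ∀ {Γ t A B} → Γ ⊢ t ∶ A → A <: B → Γ ⊢ t ∶ B
  ty-lam : ∀ {Γ a A B t} → (just (a , A) ∷ Γ) ⊢ t ∶ B → Γ ⊢ lam a A t ∶ arr a A B
  ty-con : ∀ {Γ c} → Γ ⊢ con c ∶ typeOf c
  -- Γ;Δ₁ ⊢ t:N, Γ;Δ₂ ⊢ s:A, Γ;Δ₃ ⊢ r:A, Γ;Δ₄ ⊢ q:A, A □-free
  --   ⟹ Γ;Δ₁,Δ₂,Δ₃,Δ₄ ⊢ case_A t zero s even r odd q : A
  ty-case : ∀ {Γ Δ₁ Δ₂ Δ₃ Δ₄ Θ₁ Θ₂ Θ₃ Θ₄ D E F Θ t s r q A} →
            AllNat Γ →
            Θ₁ ≔ Γ ⊎ Δ₁ → Θ₂ ≔ Γ ⊎ Δ₂ → Θ₃ ≔ Γ ⊎ Δ₃ → Θ₄ ≔ Γ ⊎ Δ₄ →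
            F ≔ Δ₃ ⊎ Δ₄ → E ≔ Δ₂ ⊎ F → D ≔ Δ₁ ⊎ E → Θ ≔ Γ ⊎ D →
            Θ₁ ⊢ t ∶ 𝐍 → Θ₂ ⊢ s ∶ A → Θ₃ ⊢ r ∶ A → Θ₄ ⊢ q ∶ A →
            BoxFree A →
            Θ ⊢ case A t s r q ∶ A
  -- Γ₁;Δ₁ ⊢ t:N, Γ₁,Γ₂;Δ₂ ⊢ s:A, Γ₁,Γ₂;∅ ⊢ r:□N→■A→A, Γ₁,Δ₁ <: □, A □-free
  --   ⟹ Γ₁,Γ₂;Δ₁,Δ₂ ⊢ recursion_A t s r : A
  ty-rec : ∀ {Γ₁ Γ₂ Δ₁ Δ₂ G T S D Θ t s r A} →
           AllNat Γ₁ → AllNat Γ₂ → G ≔ Γ₁ ⊎ Γ₂ →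
           T ≔ Γ₁ ⊎ Δ₁ → S ≔ G ⊎ Δ₂ → D ≔ Δ₁ ⊎ Δ₂ → Θ ≔ G ⊎ D →
           T ⊢ t ∶ 𝐍 → S ⊢ s ∶ A → G ⊢ r ∶ arr □ 𝐍 (arr ■ A A) →
           CtxAsp □ T → BoxFree A →
           Θ ⊢ recursion A t s r ∶ A
  -- Γ;Δ₁ ⊢ t : aA→B, Γ;Δ₂ ⊢ s : A, Γ,Δ₂ <: a  ⟹  Γ;Δ₁,Δ₂ ⊢ ts : B
  ty-app : ∀ {Γ Δ₁ Δ₂ T₁ T₂ D Θ t s a A B} →
           AllNat Γ → T₁ ≔ Γ ⊎ Δ₁ → T₂ ≔ Γ ⊎ Δ₂ → D ≔ Δ₁ ⊎ Δ₂ → Θ ≔ Γ ⊎ D →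
           T₁ ⊢ t ∶ arr a A B → T₂ ⊢ s ∶ A → CtxAsp a T₂ →
           Θ ⊢ app t s ∶ B

-- One-step reduction  t → t₁,…,tₙ  (n ∈ {1,2}), as a list

infix 4 _⟶_
data _⟶_ {n : ℕ} : Tm n → List (Tm n) → Set where
  case-zero : ∀ {A t s r} → case A (numeral 0) t s r ⟶ [ t ]
  case-even : ∀ {A k t s r} → case A (app (con S₀) (numeral k)) t s r ⟶ [ s ]
  case-odd  : ∀ {A k t s r} → case A (app (con S₁) (numeral k)) t s r ⟶ [ r ]
  rec-zero  : ∀ {A g f} → recursion A (numeral 0) g f ⟶ [ g ]
  rec-suc   : ∀ {A k g f} →
              recursion A (numeral (suc k)) g f ⟶
                [ app (app f (numeral (suc k))) (recursion A (numeral ⌊ suc k /2⌋) g f) ]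
  s0        : ∀ {k} → app (con S₀) (numeral k) ⟶ [ numeral (2 * k) ]
  s1        : ∀ {k} → app (con S₁) (numeral k) ⟶ [ numeral (2 * k + 1) ]
  p-zero    : app (con P) (numeral 0) ⟶ [ numeral 0 ]
  p-num     : ∀ {k} → app (con P) (numeral k) ⟶ [ numeral ⌊ k /2⌋ ]
  beta-N    : ∀ {a t k} → app (lam a 𝐍 t) (numeral k) ⟶ [ t [0≔ numeral k ] ]
  beta-H    : ∀ {a b B C t s} → app (lam a (arr b B C) t) s ⟶ [ t [0≔ s ] ]
  perm      : ∀ {a A t s r} →
              app (app (lam a A t) s) r ⟶ [ app (lam a A (app t (weaken r))) s ]
  rand      : con rand ⟶ numeral 0 ∷ numeral 1 ∷ []
  -- closure under term contexts (not 2nd/3rd argument of recursion)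
  cong-appˡ : ∀ {t s us} → t ⟶ us → app t s ⟶ map (λ u → app u s) us
  cong-appʳ : ∀ {t s us} → s ⟶ us → app t s ⟶ map (λ u → app t u) us
  cong-lam  : ∀ {a A t us} → t ⟶ us → lam a A t ⟶ map (lam a A) us
  cong-case₁ : ∀ {A t s r q us} → t ⟶ us → case A t s r q ⟶ map (λ u → case A u s r q) us
  cong-case₂ : ∀ {A t s r q us} → s ⟶ us → case A t s r q ⟶ map (λ u → case A t u r q) us
  cong-case₃ : ∀ {A t s r q us} → r ⟶ us → case A t s r q ⟶ map (λ u → case A t s u q) us
  cong-case₄ : ∀ {A t s r q us} → q ⟶ us → case A t s r q ⟶ map (λ u → case A t s r u) us
  cong-rec  : ∀ {A t s r us} → t ⟶ us → recursion A t s r ⟶ map (λ u → recursion A u s r) us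

-- The application, case and recursion rules split their context into a part of
-- N-typed variables shared by all premises and disjoint linear parts.  Read
-- pointwise, such a split sends each entry of the conclusion's context to exactly
-- one premise, or, if it is N-typed, possibly to several; in this form contexts
-- can be grown, shifted and split again, and weakening and substitution follow by
-- induction on derivations.  The crux of substitution is that an N-typed variable
-- may be shared, so its substituent must live in an N-typed context, which is then
-- shared in the same way.  Each redex is retyped by inverting its derivation
-- (absorbing subsumption) and reassembling the contractum.
module Submission where

open import Defs
open import Data.Nat using (ℕ; zero; suc)
open import Data.Fin using (Fin; zero; suc; punchIn; punchOut; _≟_)
open import Data.Fin.Properties using (punchIn-punchOut)
open import Data.Vec using ([]; _∷_; lookup; insertAt; replicate)
open import Data.Vec.Properties using (insertAt-punchIn)
open import Data.Vec.Relation.Unary.All as Vec using ([]; _∷_)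
open import Data.Vec.Relation.Binary.Pointwise.Inductive as Pointwise using (Pointwise; []; _∷_)
open import Data.Maybe using (Maybe; just; nothing)
open import Data.Product using (Σ; ∃; ∃₂; _×_; _,_; proj₁; proj₂)
open import Data.List using (List)
open import Data.List.Relation.Unary.All using (All; []; _∷_)
open import Data.List.Relation.Unary.All.Properties using (gmap⁺)
open import Relation.Nullary using (yes; no)
open import Relation.Binary.PropositionalEquality as ≡ using (_≡_; _≢_; refl; sym; trans; cong)

private
  variable
    n : ℕ
    a b : Asp
    X Y Z : Ty
    t s r q u : Tm n
    Θ Θ₁ Θ₂ Θ₃ Θ₄ Γ Γ₁ Γ₂ Γ₃ Δ₁ Δ₂ Δ₃ Δ₄ D E F G S T Ξ : Ctx n

<:a-refl : a <:a a
<:a-refl {□} = □□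
<:a-refl {■} = ■■

<:a-trans : ∀ {c} → a <:a b → b <:a c → a <:a c
<:a-trans □□ p  = p
<:a-trans □■ ■■ = □■
<:a-trans ■■ ■■ = ■■

arr-<:-upper : arr a X Y <: Z →
               Σ (Asp × Ty × Ty) λ (b , X′ , Y′) → Z ≡ arr b X′ Y′ × X′ <: X × Y <: Y′ × b <:a a
arr-<:-upper <:-refl        = _ , refl , <:-refl , <:-refl , <:a-refl
arr-<:-upper (<:-arr p q o) = _ , refl , p , q , o
arr-<:-upper (<:-trans p q) with arr-<:-upper p
... | _ , refl , p₁ , p₂ , p₃ with arr-<:-upper q
...   | _ , refl , q₁ , q₂ , q₃ = _ , refl , <:-trans q₁ p₁ , <:-trans p₂ q₂ , <:a-trans q₃ p₃

arr-<:-inv : ∀ {X′ Y′} → arr a X Y <: arr b X′ Y′ → X′ <: X × Y <: Y′ × b <:a a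
arr-<:-inv p with arr-<:-upper p
... | _ , refl , q = q

-- Contexts and their merges

Entry : Set
Entry = Maybe (Asp × Ty)

∅ : Ctx n
∅ = replicate _ nothing

All-∅ : ∀ {P : Entry → Set} → P nothing → Vec.All P (∅ {n})
All-∅ {n = zero}  p = []
All-∅ {n = suc n} p = p ∷ All-∅ p

AspEntry-mono : ∀ {e} → a <:a b → AspEntry a e → AspEntry b e
AspEntry-mono _ ae-nothing  = ae-nothing
AspEntry-mono q (ae-just p) = ae-just (<:a-trans p q)

AspEntry-■ : ∀ e → AspEntry ■ e
AspEntry-■ nothing        = ae-nothing
AspEntry-■ (just (□ , _)) = ae-just □■
AspEntry-■ (just (■ , _)) = ae-just ■■

CtxAsp⇒All : CtxAsp a Γ → Vec.All (AspEntry a) Γ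
CtxAsp⇒All []       = []
CtxAsp⇒All (p ∷ ps) = p ∷ CtxAsp⇒All ps

All⇒CtxAsp : Vec.All (AspEntry a) Γ → CtxAsp a Γ
All⇒CtxAsp []       = []
All⇒CtxAsp (p ∷ ps) = p ∷ All⇒CtxAsp ps

infix 4 _⊑_ _⊆_

data _⊑_ : Entry → Entry → Set where
  nothing⊑ : ∀ {e} → nothing ⊑ e
  just⊑    : ∀ {p} → just p ⊑ just p

⊑-refl : ∀ {e} → e ⊑ e
⊑-refl {nothing} = nothing⊑
⊑-refl {just _}  = just⊑

⊑-trans : ∀ {e₁ e₂ e₃} → e₁ ⊑ e₂ → e₂ ⊑ e₃ → e₁ ⊑ e₃
⊑-trans nothing⊑ _     = nothing⊑
⊑-trans just⊑    just⊑ = just⊑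

⊑-just : ∀ {e₁ e₂ p} → e₁ ⊑ e₂ → e₁ ≡ just p → e₂ ≡ just p
⊑-just just⊑ eq = eq

_⊆_ : Ctx n → Ctx n → Set
_⊆_ = Pointwise _⊑_

⊆-trans : Γ₁ ⊆ Γ₂ → Γ₂ ⊆ Γ₃ → Γ₁ ⊆ Γ₃
⊆-trans = Pointwise.trans ⊑-trans

⊆-just : ∀ {x p} → Γ₁ ⊆ Γ₂ → lookup Γ₁ x ≡ just p → lookup Γ₂ x ≡ just p
⊆-just {x = x} ss = ⊑-just (Pointwise.lookup ss x)

-- Pointwise reading of a split Γ;Δ₁,Δ₂: an entry goes to one premise, or to both
-- if it is N-typed (it then lies in Γ).
data Merge : Entry → Entry → Entry → Set where
  absent : Merge nothing nothing nothing
  onlyˡ  : ∀ {p} → Merge (just p) (just p) nothing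
  onlyʳ  : ∀ {p} → Merge (just p) nothing (just p)
  shared : Merge (just (a , 𝐍)) (just (a , 𝐍)) (just (a , 𝐍))

data Pointwise₃ (R : Entry → Entry → Entry → Set) : ∀ {n} → Ctx n → Ctx n → Ctx n → Set where
  []  : Pointwise₃ R [] [] []
  _∷_ : ∀ {n e₁ e₂ e₃} {Γ₁ Γ₂ Γ₃ : Ctx n} →
        R e₁ e₂ e₃ → Pointwise₃ R Γ₁ Γ₂ Γ₃ → Pointwise₃ R (e₁ ∷ Γ₁) (e₂ ∷ Γ₂) (e₃ ∷ Γ₃)

infix 4 _≔_⋈_

_≔_⋈_ : Ctx n → Ctx n → Ctx n → Set
_≔_⋈_ = Pointwise₃ Merge

merge-comm : ∀ {θ e₁ e₂} → Merge θ e₁ e₂ → Merge θ e₂ e₁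
merge-comm absent = absent
merge-comm onlyˡ  = onlyʳ
merge-comm onlyʳ  = onlyˡ
merge-comm shared = shared

merge-assoc : ∀ {θ e e₁ e₂ e₃} → Merge θ e e₃ → Merge e e₁ e₂ → ∃ λ f → Merge f e₂ e₃ × Merge θ e₁ f
merge-assoc absent absent = _ , absent , absent
merge-assoc onlyˡ  onlyˡ  = _ , absent , onlyˡ
merge-assoc onlyˡ  onlyʳ  = _ , onlyˡ , onlyʳ
merge-assoc onlyˡ  shared = _ , onlyˡ , shared
merge-assoc onlyʳ  absent = _ , onlyʳ , onlyʳ
merge-assoc shared onlyˡ  = _ , onlyʳ , shared
merge-assoc shared onlyʳ  = _ , shared , onlyʳ
merge-assoc shared shared = _ , shared , shared

merge-identityʳ : ∀ {e} → Merge e e nothing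
merge-identityʳ {nothing} = absent
merge-identityʳ {just _}  = onlyˡ

merge-⊑ˡ : ∀ {θ e₁ e₂} → Merge θ e₁ e₂ → e₁ ⊑ θ
merge-⊑ˡ absent = nothing⊑
merge-⊑ˡ onlyˡ  = just⊑
merge-⊑ˡ onlyʳ  = nothing⊑
merge-⊑ˡ shared = just⊑

merge-⊑ʳ : ∀ {θ e₁ e₂} → Merge θ e₁ e₂ → e₂ ⊑ θ
merge-⊑ʳ m = merge-⊑ˡ (merge-comm m)

merge-absorb : ∀ {θ e} → NatEntry e → e ⊑ θ → Merge θ e θ
merge-absorb ne-nothing nothing⊑ = merge-comm merge-identityʳ
merge-absorb ne-just    just⊑    = shared

merge-grow : ∀ {θ θ′ e₁ e₂} → Merge θ e₁ e₂ → θ ⊑ θ′ → ∃ λ e₁′ → Merge θ′ e₁′ e₂ × e₁ ⊑ e₁′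
merge-grow absent nothing⊑ = _ , merge-identityʳ , nothing⊑
merge-grow m      just⊑    = _ , m , ⊑-refl

merge-distribʳ : ∀ {θ e e₁ e₂ e₃} → NatEntry e₃ → Merge θ e e₃ → Merge e e₁ e₂ →
                 ∃₂ λ f₁ f₂ → Merge f₁ e₁ e₃ × Merge f₂ e₂ e₃ × Merge θ f₁ f₂
merge-distribʳ ne-nothing absent absent = _ , _ , absent , absent , absent
merge-distribʳ ne-nothing onlyˡ  onlyˡ  = _ , _ , onlyˡ , absent , onlyˡ
merge-distribʳ ne-nothing onlyˡ  onlyʳ  = _ , _ , absent , onlyˡ , onlyʳ
merge-distribʳ ne-nothing onlyˡ  shared = _ , _ , onlyˡ , onlyˡ , shared
merge-distribʳ ne-just    onlyʳ  absent = _ , _ , onlyʳ , onlyʳ , shared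
merge-distribʳ ne-just    shared onlyˡ  = _ , _ , shared , onlyʳ , shared
merge-distribʳ ne-just    shared onlyʳ  = _ , _ , onlyʳ , shared , shared
merge-distribʳ ne-just    shared shared = _ , _ , shared , shared , shared

merge-All : ∀ {P : Entry → Set} {θ e₁ e₂} → Merge θ e₁ e₂ → P e₁ → P e₂ → P θ
merge-All absent p₁ p₂ = p₁
merge-All onlyˡ  p₁ p₂ = p₁
merge-All onlyʳ  p₁ p₂ = p₂
merge-All shared p₁ p₂ = p₁

⋈-comm : Θ ≔ Γ₁ ⋈ Γ₂ → Θ ≔ Γ₂ ⋈ Γ₁
⋈-comm []       = []
⋈-comm (m ∷ ms) = merge-comm m ∷ ⋈-comm ms

⋈-assoc : Θ ≔ Γ ⋈ Γ₃ → Γ ≔ Γ₁ ⋈ Γ₂ → ∃ λ Δ → Δ ≔ Γ₂ ⋈ Γ₃ × Θ ≔ Γ₁ ⋈ Δ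
⋈-assoc []       []         = _ , [] , []
⋈-assoc (m ∷ ms) (m′ ∷ ms′) with merge-assoc m m′ | ⋈-assoc ms ms′
... | _ , m₁ , m₂ | _ , ms₁ , ms₂ = _ , m₁ ∷ ms₁ , m₂ ∷ ms₂

⋈-rotate : Θ ≔ Γ ⋈ Γ₃ → Γ ≔ Γ₁ ⋈ Γ₂ → ∃ λ Δ → Δ ≔ Γ₁ ⋈ Γ₃ × Θ ≔ Δ ⋈ Γ₂
⋈-rotate ms ms′ with ⋈-assoc ms (⋈-comm ms′)
... | _ , ms₁ , ms₂ = _ , ms₁ , ⋈-comm ms₂

⋈-identityʳ : Θ ≔ Θ ⋈ ∅
⋈-identityʳ {Θ = []}    = []
⋈-identityʳ {Θ = _ ∷ _} = merge-identityʳ ∷ ⋈-identityʳ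

⋈-⊆ˡ : Θ ≔ Γ₁ ⋈ Γ₂ → Γ₁ ⊆ Θ
⋈-⊆ˡ []       = []
⋈-⊆ˡ (m ∷ ms) = merge-⊑ˡ m ∷ ⋈-⊆ˡ ms

⋈-⊆ʳ : Θ ≔ Γ₁ ⋈ Γ₂ → Γ₂ ⊆ Θ
⋈-⊆ʳ ms = ⋈-⊆ˡ (⋈-comm ms)

⋈-absorb : Vec.All NatEntry Γ → Γ ⊆ Θ → Θ ≔ Γ ⋈ Θ
⋈-absorb []         []       = []
⋈-absorb (ne ∷ nes) (s ∷ ss) = merge-absorb ne s ∷ ⋈-absorb nes ss

⋈-grow : ∀ {Θ′ : Ctx n} → Θ ≔ Γ₁ ⋈ Γ₂ → Θ ⊆ Θ′ → ∃ λ Γ₁′ → Θ′ ≔ Γ₁′ ⋈ Γ₂ × Γ₁ ⊆ Γ₁′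
⋈-grow []       []       = _ , [] , []
⋈-grow (m ∷ ms) (s ∷ ss) with merge-grow m s | ⋈-grow ms ss
... | _ , m′ , s′ | _ , ms′ , ss′ = _ , m′ ∷ ms′ , s′ ∷ ss′

⋈-distribʳ : Vec.All NatEntry Γ₃ → Θ ≔ Γ ⋈ Γ₃ → Γ ≔ Γ₁ ⋈ Γ₂ →
             ∃₂ λ Δ₁ Δ₂ → Δ₁ ≔ Γ₁ ⋈ Γ₃ × Δ₂ ≔ Γ₂ ⋈ Γ₃ × Θ ≔ Δ₁ ⋈ Δ₂
⋈-distribʳ []         []       []         = _ , _ , [] , [] , []
⋈-distribʳ (ne ∷ nes) (m ∷ ms) (m′ ∷ ms′) with merge-distribʳ ne m m′ | ⋈-distribʳ nes ms ms′
... | _ , _ , m₁ , m₂ , m₃ | _ , _ , ms₁ , ms₂ , ms₃ = _ , _ , m₁ ∷ ms₁ , m₂ ∷ ms₂ , m₃ ∷ ms₃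

⋈-All : ∀ {P : Entry → Set} → Θ ≔ Γ₁ ⋈ Γ₂ → Vec.All P Γ₁ → Vec.All P Γ₂ → Vec.All P Θ
⋈-All []       []         []         = []
⋈-All (m ∷ ms) (p₁ ∷ ps₁) (p₂ ∷ ps₂) = merge-All m p₁ p₂ ∷ ⋈-All ms ps₁ ps₂

-- An entry of case t s r q is shared by all four premises (if N-typed) or goes to
-- exactly one.  For recursion t s r it is N-typed and shared by s and r or by all
-- three (the parts Γ₂ and Γ₁ of the rule), or linear in t or in s.
data CaseMerge : Entry → Entry → Entry → Entry → Entry → Set where
  absent : CaseMerge nothing nothing nothing nothing nothing
  only₁  : ∀ {p} → CaseMerge (just p) (just p) nothing nothing nothing
  only₂  : ∀ {p} → CaseMerge (just p) nothing (just p) nothing nothing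
  only₃  : ∀ {p} → CaseMerge (just p) nothing nothing (just p) nothing
  only₄  : ∀ {p} → CaseMerge (just p) nothing nothing nothing (just p)
  shared : let e = just (a , 𝐍) in CaseMerge e e e e e

data RecMerge : Entry → Entry → Entry → Entry → Set where
  absent   : RecMerge nothing nothing nothing nothing
  onlyₜ    : ∀ {p} → RecMerge (just p) (just p) nothing nothing
  onlyₛ    : ∀ {p} → RecMerge (just p) nothing (just p) nothing
  sharedₛᵣ : let e = just (a , 𝐍) in RecMerge e nothing e e
  shared   : let e = just (a , 𝐍) in RecMerge e e e e

data Pointwise₄ (R : Entry → Entry → Entry → Entry → Set) :
                ∀ {n} → Ctx n → Ctx n → Ctx n → Ctx n → Set where
  []  : Pointwise₄ R [] [] [] []
  _∷_ : ∀ {n e₁ e₂ e₃ e₄} {Γ₁ Γ₂ Γ₃ Γ₄ : Ctx n} → R e₁ e₂ e₃ e₄ → Pointwise₄ R Γ₁ Γ₂ Γ₃ Γ₄ →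
        Pointwise₄ R (e₁ ∷ Γ₁) (e₂ ∷ Γ₂) (e₃ ∷ Γ₃) (e₄ ∷ Γ₄)

data Pointwise₅ (R : Entry → Entry → Entry → Entry → Entry → Set) :
                ∀ {n} → Ctx n → Ctx n → Ctx n → Ctx n → Ctx n → Set where
  []  : Pointwise₅ R [] [] [] [] []
  _∷_ : ∀ {n e₁ e₂ e₃ e₄ e₅} {Γ₁ Γ₂ Γ₃ Γ₄ Γ₅ : Ctx n} → R e₁ e₂ e₃ e₄ e₅ →
        Pointwise₅ R Γ₁ Γ₂ Γ₃ Γ₄ Γ₅ → Pointwise₅ R (e₁ ∷ Γ₁) (e₂ ∷ Γ₂) (e₃ ∷ Γ₃) (e₄ ∷ Γ₄) (e₅ ∷ Γ₅)

caseMerge⇒chain : ∀ {θ e₁ e₂ e₃ e₄} → CaseMerge θ e₁ e₂ e₃ e₄ →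
                  ∃₂ λ e f → Merge θ e₁ e × Merge e e₂ f × Merge f e₃ e₄
caseMerge⇒chain absent = _ , _ , absent , absent , absent
caseMerge⇒chain only₁  = _ , _ , onlyˡ , absent , absent
caseMerge⇒chain only₂  = _ , _ , onlyʳ , onlyˡ , absent
caseMerge⇒chain only₃  = _ , _ , onlyʳ , onlyʳ , onlyˡ
caseMerge⇒chain only₄  = _ , _ , onlyʳ , onlyʳ , onlyʳ
caseMerge⇒chain shared = _ , _ , shared , shared , shared

-- A chain of merges may share an N-typed entry among only some of the premises;
-- handing it to all of them restores the case pattern.
chain⇒caseMerge : ∀ {θ e₁ e e₂ f e₃ e₄} → Merge θ e₁ e → Merge e e₂ f → Merge f e₃ e₄ →
                  Σ (Entry × Entry × Entry × Entry) λ (e₁′ , e₂′ , e₃′ , e₄′) →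
                    CaseMerge θ e₁′ e₂′ e₃′ e₄′ × e₁ ⊑ e₁′ × e₂ ⊑ e₂′ × e₃ ⊑ e₃′ × e₄ ⊑ e₄′
chain⇒caseMerge {nothing} absent absent absent = _ , absent , nothing⊑ , nothing⊑ , nothing⊑ , nothing⊑
chain⇒caseMerge {θ@(just (_ , 𝐍))} {f = f} m₁ m₂ m₃ =
  _ , shared , merge-⊑ˡ m₁ , ⊑-trans (merge-⊑ˡ m₂) (merge-⊑ʳ m₁) ,
  ⊑-trans (merge-⊑ˡ m₃) f⊑θ , ⊑-trans (merge-⊑ʳ m₃) f⊑θ
  where
  f⊑θ : f ⊑ θ
  f⊑θ = ⊑-trans (merge-⊑ʳ m₂) (merge-⊑ʳ m₁)
chain⇒caseMerge {just (_ , arr _ _ _)} onlyˡ absent absent = _ , only₁ , just⊑ , nothing⊑ , nothing⊑ , nothing⊑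
chain⇒caseMerge {just (_ , arr _ _ _)} onlyʳ onlyˡ absent  = _ , only₂ , nothing⊑ , just⊑ , nothing⊑ , nothing⊑
chain⇒caseMerge {just (_ , arr _ _ _)} onlyʳ onlyʳ onlyˡ   = _ , only₃ , nothing⊑ , nothing⊑ , just⊑ , nothing⊑
chain⇒caseMerge {just (_ , arr _ _ _)} onlyʳ onlyʳ onlyʳ   = _ , only₄ , nothing⊑ , nothing⊑ , nothing⊑ , just⊑

recMerge⇒chain : ∀ {θ e₁ e₂ e₃} → RecMerge θ e₁ e₂ e₃ → NatEntry e₃ × ∃ λ e → Merge θ e₁ e × Merge e e₂ e₃
recMerge⇒chain absent   = ne-nothing , _ , absent , absent
recMerge⇒chain onlyₜ    = ne-nothing , _ , onlyˡ , absent
recMerge⇒chain onlyₛ    = ne-nothing , _ , onlyʳ , onlyˡ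
recMerge⇒chain sharedₛᵣ = ne-just , _ , onlyʳ , shared
recMerge⇒chain shared   = ne-just , _ , shared , shared

chain⇒recMerge : ∀ {θ e₁ e e₂ e₃} → NatEntry e₃ → Merge θ e₁ e → Merge e e₂ e₃ →
                 ∃₂ λ e₂′ e₃′ → RecMerge θ e₁ e₂′ e₃′ × e₂ ⊑ e₂′ × e₃ ⊑ e₃′
chain⇒recMerge ne-nothing absent absent = _ , _ , absent , nothing⊑ , nothing⊑
chain⇒recMerge ne-nothing onlyˡ  absent = _ , _ , onlyₜ , nothing⊑ , nothing⊑
chain⇒recMerge ne-nothing onlyʳ  onlyˡ  = _ , _ , onlyₛ , just⊑ , nothing⊑
chain⇒recMerge ne-nothing shared onlyˡ  = _ , _ , shared , just⊑ , nothing⊑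
chain⇒recMerge ne-just    onlyʳ  onlyʳ  = _ , _ , sharedₛᵣ , nothing⊑ , just⊑
chain⇒recMerge ne-just    onlyʳ  shared = _ , _ , sharedₛᵣ , just⊑ , just⊑
chain⇒recMerge ne-just    shared onlyʳ  = _ , _ , shared , nothing⊑ , just⊑
chain⇒recMerge ne-just    shared shared = _ , _ , shared , just⊑ , just⊑

caseMerge-grow : ∀ {θ θ′ e₁ e₂ e₃ e₄} → CaseMerge θ e₁ e₂ e₃ e₄ → θ ⊑ θ′ →
                 ∃ λ e₁′ → CaseMerge θ′ e₁′ e₂ e₃ e₄ × e₁ ⊑ e₁′
caseMerge-grow {θ′ = nothing} absent nothing⊑ = _ , absent , nothing⊑
caseMerge-grow {θ′ = just _}  absent nothing⊑ = _ , only₁ , nothing⊑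
caseMerge-grow                m      just⊑    = _ , m , ⊑-refl

recMerge-grow : ∀ {θ θ′ e₁ e₂ e₃} → RecMerge θ e₁ e₂ e₃ → θ ⊑ θ′ →
                ∃ λ e₂′ → RecMerge θ′ e₁ e₂′ e₃ × e₂ ⊑ e₂′
recMerge-grow {θ′ = nothing} absent nothing⊑ = _ , absent , nothing⊑
recMerge-grow {θ′ = just _}  absent nothing⊑ = _ , onlyₛ , nothing⊑
recMerge-grow                m      just⊑    = _ , m , ⊑-refl

caseMerges⇒chain : Pointwise₅ CaseMerge Θ Θ₁ Θ₂ Θ₃ Θ₄ →
                   ∃₂ λ E F → Θ ≔ Θ₁ ⋈ E × E ≔ Θ₂ ⋈ F × F ≔ Θ₃ ⋈ Θ₄
caseMerges⇒chain []       = _ , _ , [] , [] , []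
caseMerges⇒chain (m ∷ ms) with caseMerge⇒chain m | caseMerges⇒chain ms
... | _ , _ , m₁ , m₂ , m₃ | _ , _ , ms₁ , ms₂ , ms₃ = _ , _ , m₁ ∷ ms₁ , m₂ ∷ ms₂ , m₃ ∷ ms₃

chain⇒caseMerges : Θ ≔ Θ₁ ⋈ E → E ≔ Θ₂ ⋈ F → F ≔ Θ₃ ⋈ Θ₄ →
                   Σ (Ctx _ × Ctx _ × Ctx _ × Ctx _) λ (Θ₁′ , Θ₂′ , Θ₃′ , Θ₄′) →
                     Pointwise₅ CaseMerge Θ Θ₁′ Θ₂′ Θ₃′ Θ₄′ ×
                     Θ₁ ⊆ Θ₁′ × Θ₂ ⊆ Θ₂′ × Θ₃ ⊆ Θ₃′ × Θ₄ ⊆ Θ₄′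
chain⇒caseMerges []         []         []         = _ , [] , [] , [] , [] , []
chain⇒caseMerges (m₁ ∷ ms₁) (m₂ ∷ ms₂) (m₃ ∷ ms₃)
  with chain⇒caseMerge m₁ m₂ m₃ | chain⇒caseMerges ms₁ ms₂ ms₃
... | _ , m , s₁ , s₂ , s₃ , s₄ | _ , ms , ss₁ , ss₂ , ss₃ , ss₄ =
  _ , m ∷ ms , s₁ ∷ ss₁ , s₂ ∷ ss₂ , s₃ ∷ ss₃ , s₄ ∷ ss₄

recMerges⇒chain : Pointwise₄ RecMerge Θ T S G → Vec.All NatEntry G × ∃ λ E → Θ ≔ T ⋈ E × E ≔ S ⋈ G
recMerges⇒chain []       = [] , _ , [] , []
recMerges⇒chain (m ∷ ms) with recMerge⇒chain m | recMerges⇒chain ms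
... | ne , _ , m₁ , m₂ | nes , _ , ms₁ , ms₂ = ne ∷ nes , _ , m₁ ∷ ms₁ , m₂ ∷ ms₂

chain⇒recMerges : Vec.All NatEntry G → Θ ≔ T ⋈ E → E ≔ S ⋈ G →
                  ∃₂ λ S′ G′ → Pointwise₄ RecMerge Θ T S′ G′ × S ⊆ S′ × G ⊆ G′
chain⇒recMerges []         []         []         = _ , _ , [] , [] , []
chain⇒recMerges (ne ∷ nes) (m₁ ∷ ms₁) (m₂ ∷ ms₂)
  with chain⇒recMerge ne m₁ m₂ | chain⇒recMerges nes ms₁ ms₂
... | _ , _ , m , s , r | _ , _ , ms , ss , rs = _ , _ , m ∷ ms , s ∷ ss , r ∷ rs

caseMerges-grow : ∀ {Θ′ : Ctx n} → Pointwise₅ CaseMerge Θ Θ₁ Θ₂ Θ₃ Θ₄ → Θ ⊆ Θ′ →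
                  ∃ λ Θ₁′ → Pointwise₅ CaseMerge Θ′ Θ₁′ Θ₂ Θ₃ Θ₄ × Θ₁ ⊆ Θ₁′
caseMerges-grow []       []       = _ , [] , []
caseMerges-grow (m ∷ ms) (s ∷ ss) with caseMerge-grow m s | caseMerges-grow ms ss
... | _ , m′ , s′ | _ , ms′ , ss′ = _ , m′ ∷ ms′ , s′ ∷ ss′

recMerges-grow : ∀ {Θ′ : Ctx n} → Pointwise₄ RecMerge Θ T S G → Θ ⊆ Θ′ →
                 ∃ λ S′ → Pointwise₄ RecMerge Θ′ T S′ G × S ⊆ S′
recMerges-grow []       []       = _ , [] , []
recMerges-grow (m ∷ ms) (s ∷ ss) with recMerge-grow m s | recMerges-grow ms ss
... | _ , m′ , s′ | _ , ms′ , ss′ = _ , m′ ∷ ms′ , s′ ∷ ss′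

module _ {R : Entry → Entry → Entry → Set} (r : R nothing nothing nothing) where

  Pointwise₃-insertAt : Pointwise₃ R Γ₁ Γ₂ Γ₃ → (j : Fin (suc n)) →
    Pointwise₃ R (insertAt Γ₁ j nothing) (insertAt Γ₂ j nothing) (insertAt Γ₃ j nothing)
  Pointwise₃-insertAt rs       zero    = r ∷ rs
  Pointwise₃-insertAt (x ∷ rs) (suc j) = x ∷ Pointwise₃-insertAt rs j

module _ {R : Entry → Entry → Entry → Entry → Set} (r : R nothing nothing nothing nothing) where

  Pointwise₄-insertAt : ∀ {Γ₄ : Ctx n} → Pointwise₄ R Γ₁ Γ₂ Γ₃ Γ₄ → (j : Fin (suc n)) →
    Pointwise₄ R (insertAt Γ₁ j nothing) (insertAt Γ₂ j nothing) (insertAt Γ₃ j nothing)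
                 (insertAt Γ₄ j nothing)
  Pointwise₄-insertAt rs       zero    = r ∷ rs
  Pointwise₄-insertAt (x ∷ rs) (suc j) = x ∷ Pointwise₄-insertAt rs j

module _ {R : Entry → Entry → Entry → Entry → Entry → Set} (r : R nothing nothing nothing nothing nothing) where

  Pointwise₅-insertAt : ∀ {Γ₄ Γ₅ : Ctx n} → Pointwise₅ R Γ₁ Γ₂ Γ₃ Γ₄ Γ₅ → (j : Fin (suc n)) →
    Pointwise₅ R (insertAt Γ₁ j nothing) (insertAt Γ₂ j nothing) (insertAt Γ₃ j nothing)
                 (insertAt Γ₄ j nothing) (insertAt Γ₅ j nothing)
  Pointwise₅-insertAt rs       zero    = r ∷ rs
  Pointwise₅-insertAt (x ∷ rs) (suc j) = x ∷ Pointwise₅-insertAt rs j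

All-insertAt : ∀ {P : Entry → Set} → P nothing → Vec.All P Γ → (j : Fin (suc n)) →
               Vec.All P (insertAt Γ j nothing)
All-insertAt p ps       zero    = p ∷ ps
All-insertAt p (x ∷ ps) (suc j) = x ∷ All-insertAt p ps j

appSplit⇒⋈ : AllNat Γ → Θ₁ ≔ Γ ⊎ Δ₁ → Θ₂ ≔ Γ ⊎ Δ₂ → D ≔ Δ₁ ⊎ Δ₂ → Θ ≔ Γ ⊎ D → Θ ≔ Θ₁ ⋈ Θ₂
appSplit⇒⋈ [] [] [] [] [] = []
appSplit⇒⋈ (ne-nothing ∷ an) (none q₁) (none q₂) (none q) (none q′) = absent ∷ appSplit⇒⋈ an q₁ q₂ q q′
appSplit⇒⋈ (ne-nothing ∷ an) (right q₁) (none q₂) (left q) (right q′) = onlyˡ ∷ appSplit⇒⋈ an q₁ q₂ q q′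
appSplit⇒⋈ (ne-nothing ∷ an) (none q₁) (right q₂) (right q) (right q′) = onlyʳ ∷ appSplit⇒⋈ an q₁ q₂ q q′
appSplit⇒⋈ (ne-just ∷ an) (left q₁) (left q₂) (none q) (left q′) = shared ∷ appSplit⇒⋈ an q₁ q₂ q q′

data AppSplit (Θ Θ₁ Θ₂ : Ctx n) : Set where
  appSplit : AllNat Γ → Θ₁ ≔ Γ ⊎ Δ₁ → Θ₂ ≔ Γ ⊎ Δ₂ → D ≔ Δ₁ ⊎ Δ₂ → Θ ≔ Γ ⊎ D → AppSplit Θ Θ₁ Θ₂

⋈⇒appSplit : Θ ≔ Θ₁ ⋈ Θ₂ → AppSplit Θ Θ₁ Θ₂
⋈⇒appSplit [] = appSplit [] [] [] [] []
⋈⇒appSplit (m ∷ ms) with m | ⋈⇒appSplit ms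
... | absent | appSplit an q₁ q₂ q q′ = appSplit (ne-nothing ∷ an) (none q₁) (none q₂) (none q) (none q′)
... | onlyˡ  | appSplit an q₁ q₂ q q′ = appSplit (ne-nothing ∷ an) (right q₁) (none q₂) (left q) (right q′)
... | onlyʳ  | appSplit an q₁ q₂ q q′ = appSplit (ne-nothing ∷ an) (none q₁) (right q₂) (right q) (right q′)
... | shared | appSplit an q₁ q₂ q q′ = appSplit (ne-just ∷ an) (left q₁) (left q₂) (none q) (left q′)

caseSplit⇒caseMerges : AllNat Γ → Θ₁ ≔ Γ ⊎ Δ₁ → Θ₂ ≔ Γ ⊎ Δ₂ → Θ₃ ≔ Γ ⊎ Δ₃ → Θ₄ ≔ Γ ⊎ Δ₄ →
  F ≔ Δ₃ ⊎ Δ₄ → E ≔ Δ₂ ⊎ F → D ≔ Δ₁ ⊎ E → Θ ≔ Γ ⊎ D → Pointwise₅ CaseMerge Θ Θ₁ Θ₂ Θ₃ Θ₄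
caseSplit⇒caseMerges [] [] [] [] [] [] [] [] [] = []
caseSplit⇒caseMerges (ne-nothing ∷ an) (none q₁) (none q₂) (none q₃) (none q₄) (none f) (none e) (none d) (none q) =
  absent ∷ caseSplit⇒caseMerges an q₁ q₂ q₃ q₄ f e d q
caseSplit⇒caseMerges (ne-nothing ∷ an) (right q₁) (none q₂) (none q₃) (none q₄) (none f) (none e) (left d) (right q) =
  only₁ ∷ caseSplit⇒caseMerges an q₁ q₂ q₃ q₄ f e d q
caseSplit⇒caseMerges (ne-nothing ∷ an) (none q₁) (right q₂) (none q₃) (none q₄) (none f) (left e) (right d) (right q) =
  only₂ ∷ caseSplit⇒caseMerges an q₁ q₂ q₃ q₄ f e d q
caseSplit⇒caseMerges (ne-nothing ∷ an) (none q₁) (none q₂) (right q₃) (none q₄) (left f) (right e) (right d) (right q) =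
  only₃ ∷ caseSplit⇒caseMerges an q₁ q₂ q₃ q₄ f e d q
caseSplit⇒caseMerges (ne-nothing ∷ an) (none q₁) (none q₂) (none q₃) (right q₄) (right f) (right e) (right d) (right q) =
  only₄ ∷ caseSplit⇒caseMerges an q₁ q₂ q₃ q₄ f e d q
caseSplit⇒caseMerges (ne-just ∷ an) (left q₁) (left q₂) (left q₃) (left q₄) (none f) (none e) (none d) (left q) =
  shared ∷ caseSplit⇒caseMerges an q₁ q₂ q₃ q₄ f e d q

data CaseSplit (Θ Θ₁ Θ₂ Θ₃ Θ₄ : Ctx n) : Set where
  caseSplit : AllNat Γ → Θ₁ ≔ Γ ⊎ Δ₁ → Θ₂ ≔ Γ ⊎ Δ₂ → Θ₃ ≔ Γ ⊎ Δ₃ → Θ₄ ≔ Γ ⊎ Δ₄ →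
              F ≔ Δ₃ ⊎ Δ₄ → E ≔ Δ₂ ⊎ F → D ≔ Δ₁ ⊎ E → Θ ≔ Γ ⊎ D → CaseSplit Θ Θ₁ Θ₂ Θ₃ Θ₄

caseMerges⇒caseSplit : Pointwise₅ CaseMerge Θ Θ₁ Θ₂ Θ₃ Θ₄ → CaseSplit Θ Θ₁ Θ₂ Θ₃ Θ₄
caseMerges⇒caseSplit [] = caseSplit [] [] [] [] [] [] [] [] []
caseMerges⇒caseSplit (m ∷ ms) with m | caseMerges⇒caseSplit ms
... | absent | caseSplit an q₁ q₂ q₃ q₄ f e d q =
  caseSplit (ne-nothing ∷ an) (none q₁) (none q₂) (none q₃) (none q₄) (none f) (none e) (none d) (none q)
... | only₁ | caseSplit an q₁ q₂ q₃ q₄ f e d q =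
  caseSplit (ne-nothing ∷ an) (right q₁) (none q₂) (none q₃) (none q₄) (none f) (none e) (left d) (right q)
... | only₂ | caseSplit an q₁ q₂ q₃ q₄ f e d q =
  caseSplit (ne-nothing ∷ an) (none q₁) (right q₂) (none q₃) (none q₄) (none f) (left e) (right d) (right q)
... | only₃ | caseSplit an q₁ q₂ q₃ q₄ f e d q =
  caseSplit (ne-nothing ∷ an) (none q₁) (none q₂) (right q₃) (none q₄) (left f) (right e) (right d) (right q)
... | only₄ | caseSplit an q₁ q₂ q₃ q₄ f e d q =
  caseSplit (ne-nothing ∷ an) (none q₁) (none q₂) (none q₃) (right q₄) (right f) (right e) (right d) (right q)
... | shared | caseSplit an q₁ q₂ q₃ q₄ f e d q =
  caseSplit (ne-just ∷ an) (left q₁) (left q₂) (left q₃) (left q₄) (none f) (none e) (none d) (left q)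

recSplit⇒recMerges : AllNat Γ₁ → AllNat Γ₂ → G ≔ Γ₁ ⊎ Γ₂ →
  T ≔ Γ₁ ⊎ Δ₁ → S ≔ G ⊎ Δ₂ → D ≔ Δ₁ ⊎ Δ₂ → Θ ≔ G ⊎ D → Pointwise₄ RecMerge Θ T S G
recSplit⇒recMerges [] [] [] [] [] [] [] = []
recSplit⇒recMerges (ne-nothing ∷ a₁) (ne-nothing ∷ a₂) (none g) (none t) (none s) (none d) (none q) =
  absent ∷ recSplit⇒recMerges a₁ a₂ g t s d q
recSplit⇒recMerges (ne-nothing ∷ a₁) (ne-nothing ∷ a₂) (none g) (right t) (none s) (left d) (right q) =
  onlyₜ ∷ recSplit⇒recMerges a₁ a₂ g t s d q
recSplit⇒recMerges (ne-nothing ∷ a₁) (ne-nothing ∷ a₂) (none g) (none t) (right s) (right d) (right q) =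
  onlyₛ ∷ recSplit⇒recMerges a₁ a₂ g t s d q
recSplit⇒recMerges (ne-nothing ∷ a₁) (ne-just ∷ a₂) (right g) (none t) (left s) (none d) (left q) =
  sharedₛᵣ ∷ recSplit⇒recMerges a₁ a₂ g t s d q
recSplit⇒recMerges (ne-just ∷ a₁) (ne-nothing ∷ a₂) (left g) (left t) (left s) (none d) (left q) =
  shared ∷ recSplit⇒recMerges a₁ a₂ g t s d q

data RecSplit (Θ T S G : Ctx n) : Set where
  recSplit : AllNat Γ₁ → AllNat Γ₂ → G ≔ Γ₁ ⊎ Γ₂ →
             T ≔ Γ₁ ⊎ Δ₁ → S ≔ G ⊎ Δ₂ → D ≔ Δ₁ ⊎ Δ₂ → Θ ≔ G ⊎ D → RecSplit Θ T S G

recMerges⇒recSplit : Pointwise₄ RecMerge Θ T S G → RecSplit Θ T S G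
recMerges⇒recSplit [] = recSplit [] [] [] [] [] [] []
recMerges⇒recSplit (m ∷ ms) with m | recMerges⇒recSplit ms
... | absent | recSplit a₁ a₂ g t s d q =
  recSplit (ne-nothing ∷ a₁) (ne-nothing ∷ a₂) (none g) (none t) (none s) (none d) (none q)
... | onlyₜ | recSplit a₁ a₂ g t s d q =
  recSplit (ne-nothing ∷ a₁) (ne-nothing ∷ a₂) (none g) (right t) (none s) (left d) (right q)
... | onlyₛ | recSplit a₁ a₂ g t s d q =
  recSplit (ne-nothing ∷ a₁) (ne-nothing ∷ a₂) (none g) (none t) (right s) (right d) (right q)
... | sharedₛᵣ | recSplit a₁ a₂ g t s d q =
  recSplit (ne-nothing ∷ a₁) (ne-just ∷ a₂) (right g) (none t) (left s) (none d) (left q)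
... | shared | recSplit a₁ a₂ g t s d q =
  recSplit (ne-just ∷ a₁) (ne-nothing ∷ a₂) (left g) (left t) (left s) (none d) (left q)

-- The typing rules in pointwise form

⊢-app : Θ ≔ Θ₁ ⋈ Θ₂ → Θ₁ ⊢ t ∶ arr a X Y → Θ₂ ⊢ s ∶ X → Vec.All (AspEntry a) Θ₂ → Θ ⊢ app t s ∶ Y
⊢-app ms d₁ d₂ asp with ⋈⇒appSplit ms
... | appSplit an q₁ q₂ q q′ = ty-app an q₁ q₂ q q′ d₁ d₂ (All⇒CtxAsp asp)

⊢-case : Pointwise₅ CaseMerge Θ Θ₁ Θ₂ Θ₃ Θ₄ →
         Θ₁ ⊢ t ∶ 𝐍 → Θ₂ ⊢ s ∶ X → Θ₃ ⊢ r ∶ X → Θ₄ ⊢ q ∶ X → BoxFree X → Θ ⊢ case X t s r q ∶ X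
⊢-case ms d₁ d₂ d₃ d₄ bf with caseMerges⇒caseSplit ms
... | caseSplit an q₁ q₂ q₃ q₄ f e d q = ty-case an q₁ q₂ q₃ q₄ f e d q d₁ d₂ d₃ d₄ bf

⊢-rec : Pointwise₄ RecMerge Θ T S G → T ⊢ t ∶ 𝐍 → S ⊢ s ∶ X → G ⊢ r ∶ arr □ 𝐍 (arr ■ X X) →
        Vec.All (AspEntry □) T → BoxFree X → Θ ⊢ recursion X t s r ∶ X
⊢-rec ms d₁ d₂ d₃ asp bf with recMerges⇒recSplit ms
... | recSplit a₁ a₂ g t s d q = ty-rec a₁ a₂ g t s d q d₁ d₂ d₃ (All⇒CtxAsp asp) bf

data AppInv (Θ : Ctx n) (t s : Tm n) (Z : Ty) : Set where
  appInv : Θ ≔ Θ₁ ⋈ Θ₂ → Θ₁ ⊢ t ∶ arr a X Y → Θ₂ ⊢ s ∶ X → Vec.All (AspEntry a) Θ₂ → Y <: Z →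
           AppInv Θ t s Z

app-inv : Θ ⊢ app t s ∶ Z → AppInv Θ t s Z
app-inv (ty-sub d p) with app-inv d
... | appInv ms d₁ d₂ asp o = appInv ms d₁ d₂ asp (<:-trans o p)
app-inv (ty-app an q₁ q₂ q q′ d₁ d₂ asp) = appInv (appSplit⇒⋈ an q₁ q₂ q q′) d₁ d₂ (CtxAsp⇒All asp) <:-refl

data CaseInv (Θ : Ctx n) (X : Ty) (t s r q : Tm n) (Z : Ty) : Set where
  caseInv : Pointwise₅ CaseMerge Θ Θ₁ Θ₂ Θ₃ Θ₄ →
            Θ₁ ⊢ t ∶ 𝐍 → Θ₂ ⊢ s ∶ X → Θ₃ ⊢ r ∶ X → Θ₄ ⊢ q ∶ X → BoxFree X → X <: Z →
            CaseInv Θ X t s r q Z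

case-inv : Θ ⊢ case X t s r q ∶ Z → CaseInv Θ X t s r q Z
case-inv (ty-sub d p) with case-inv d
... | caseInv ms d₁ d₂ d₃ d₄ bf o = caseInv ms d₁ d₂ d₃ d₄ bf (<:-trans o p)
case-inv (ty-case an q₁ q₂ q₃ q₄ f e d q d₁ d₂ d₃ d₄ bf) =
  caseInv (caseSplit⇒caseMerges an q₁ q₂ q₃ q₄ f e d q) d₁ d₂ d₃ d₄ bf <:-refl

data RecInv (Θ : Ctx n) (X : Ty) (t s r : Tm n) (Z : Ty) : Set where
  recInv : Pointwise₄ RecMerge Θ T S G → T ⊢ t ∶ 𝐍 → S ⊢ s ∶ X → G ⊢ r ∶ arr □ 𝐍 (arr ■ X X) →
           Vec.All (AspEntry □) T → BoxFree X → X <: Z → RecInv Θ X t s r Z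

rec-inv : Θ ⊢ recursion X t s r ∶ Z → RecInv Θ X t s r Z
rec-inv (ty-sub d p) with rec-inv d
... | recInv ms d₁ d₂ d₃ asp bf o = recInv ms d₁ d₂ d₃ asp bf (<:-trans o p)
rec-inv (ty-rec a₁ a₂ g t s d q d₁ d₂ d₃ asp bf) =
  recInv (recSplit⇒recMerges a₁ a₂ g t s d q) d₁ d₂ d₃ (CtxAsp⇒All asp) bf <:-refl

lam-inv : Θ ⊢ lam a X t ∶ Z → ∃ λ Y → (just (a , X) ∷ Θ) ⊢ t ∶ Y × arr a X Y <: Z
lam-inv (ty-lam d)   = _ , d , <:-refl
lam-inv (ty-sub d p) with lam-inv d
... | _ , d′ , o = _ , d′ , <:-trans o p

con-inv : ∀ {c} → Θ ⊢ con c ∶ Z → typeOf c <: Z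
con-inv ty-con       = <:-refl
con-inv (ty-sub d p) = <:-trans (con-inv d) p

-- Weakening and shifting

-- The new entries go to the premise that carries no side condition on its context:
-- the function of an application, the scrutinee of a case, the base of a recursion.
⊢-⊆ : ∀ {Θ′ : Ctx n} → Θ ⊢ t ∶ X → Θ ⊆ Θ′ → Θ′ ⊢ t ∶ X
⊢-⊆ (ty-var e)   ss = ty-var (⊆-just ss e)
⊢-⊆ (ty-sub d p) ss = ty-sub (⊢-⊆ d ss) p
⊢-⊆ (ty-lam d)   ss = ty-lam (⊢-⊆ d (just⊑ ∷ ss))
⊢-⊆ ty-con       ss = ty-con
⊢-⊆ (ty-app an q₁ q₂ q q′ d₁ d₂ asp) ss with ⋈-grow (appSplit⇒⋈ an q₁ q₂ q q′) ss
... | _ , ms , ss₁ = ⊢-app ms (⊢-⊆ d₁ ss₁) d₂ (CtxAsp⇒All asp)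
⊢-⊆ (ty-case an q₁ q₂ q₃ q₄ f e d q d₁ d₂ d₃ d₄ bf) ss
  with caseMerges-grow (caseSplit⇒caseMerges an q₁ q₂ q₃ q₄ f e d q) ss
... | _ , ms , ss₁ = ⊢-case ms (⊢-⊆ d₁ ss₁) d₂ d₃ d₄ bf
⊢-⊆ (ty-rec a₁ a₂ g t s d q d₁ d₂ d₃ asp bf) ss
  with recMerges-grow (recSplit⇒recMerges a₁ a₂ g t s d q) ss
... | _ , ms , ss₂ = ⊢-rec ms d₁ (⊢-⊆ d₂ ss₂) d₃ (CtxAsp⇒All asp) bf

⊢-shift : ∀ {ρ : Fin n → Fin (suc n)} → Θ ⊢ t ∶ X → (j : Fin (suc n)) →
          (∀ i → ρ i ≡ punchIn j i) → insertAt Θ j nothing ⊢ rename ρ t ∶ X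
⊢-shift {Θ = Θ} (ty-var {x = x} e) j ρ≗ =
  ty-var (trans (cong (lookup (insertAt Θ j nothing)) (ρ≗ x)) (trans (insertAt-punchIn Θ j nothing x) e))
⊢-shift (ty-sub d p) j ρ≗ = ty-sub (⊢-shift d j ρ≗) p
⊢-shift ty-con       j ρ≗ = ty-con
⊢-shift {ρ = ρ} (ty-lam d) j ρ≗ = ty-lam (⊢-shift d (suc j) ext-ρ≗)
  where
  ext-ρ≗ : ∀ i → ext ρ i ≡ punchIn (suc j) i
  ext-ρ≗ zero    = refl
  ext-ρ≗ (suc i) = cong suc (ρ≗ i)
⊢-shift (ty-app an q₁ q₂ q q′ d₁ d₂ asp) j ρ≗ =
  ⊢-app (Pointwise₃-insertAt absent (appSplit⇒⋈ an q₁ q₂ q q′) j)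
        (⊢-shift d₁ j ρ≗) (⊢-shift d₂ j ρ≗) (All-insertAt ae-nothing (CtxAsp⇒All asp) j)
⊢-shift (ty-case an q₁ q₂ q₃ q₄ f e d q d₁ d₂ d₃ d₄ bf) j ρ≗ =
  ⊢-case (Pointwise₅-insertAt absent (caseSplit⇒caseMerges an q₁ q₂ q₃ q₄ f e d q) j)
         (⊢-shift d₁ j ρ≗) (⊢-shift d₂ j ρ≗) (⊢-shift d₃ j ρ≗) (⊢-shift d₄ j ρ≗) bf
⊢-shift (ty-rec a₁ a₂ g t s d q d₁ d₂ d₃ asp bf) j ρ≗ =
  ⊢-rec (Pointwise₄-insertAt absent (recSplit⇒recMerges a₁ a₂ g t s d q) j)
        (⊢-shift d₁ j ρ≗) (⊢-shift d₂ j ρ≗) (⊢-shift d₃ j ρ≗) (All-insertAt ae-nothing (CtxAsp⇒All asp) j) bf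

⊢-weaken : Θ ⊢ t ∶ X → (nothing ∷ Θ) ⊢ weaken t ∶ X
⊢-weaken d = ⊢-shift d zero (λ _ → refl)

⊢-case-chain : Θ ≔ Θ₁ ⋈ E → E ≔ Θ₂ ⋈ F → F ≔ Θ₃ ⋈ Θ₄ →
               Θ₁ ⊢ t ∶ 𝐍 → Θ₂ ⊢ s ∶ X → Θ₃ ⊢ r ∶ X → Θ₄ ⊢ q ∶ X → BoxFree X → Θ ⊢ case X t s r q ∶ X
⊢-case-chain ms₁ ms₂ ms₃ d₁ d₂ d₃ d₄ bf with chain⇒caseMerges ms₁ ms₂ ms₃
... | _ , ms , s₁ , s₂ , s₃ , s₄ = ⊢-case ms (⊢-⊆ d₁ s₁) (⊢-⊆ d₂ s₂) (⊢-⊆ d₃ s₃) (⊢-⊆ d₄ s₄) bf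

⊢-rec-chain : Vec.All NatEntry G → Θ ≔ T ⋈ E → E ≔ S ⋈ G →
              T ⊢ t ∶ 𝐍 → S ⊢ s ∶ X → G ⊢ r ∶ arr □ 𝐍 (arr ■ X X) →
              Vec.All (AspEntry □) T → BoxFree X → Θ ⊢ recursion X t s r ∶ X
⊢-rec-chain nes ms₁ ms₂ d₁ d₂ d₃ asp bf with chain⇒recMerges nes ms₁ ms₂
... | _ , _ , ms , s₂ , s₃ = ⊢-rec ms d₁ (⊢-⊆ d₂ s₂) (⊢-⊆ d₃ s₃) asp bf

-- Substitution

data Insert : Fin (suc n) → Entry → Ctx n → Ctx (suc n) → Set where
  here  : ∀ {e} → Insert zero e Θ (e ∷ Θ)
  there : ∀ {j e x} {Θ′ : Ctx (suc n)} → Insert j e Θ Θ′ → Insert (suc j) e (x ∷ Θ) (x ∷ Θ′)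

Insert-lookup : ∀ {j e} {Θ′ : Ctx (suc n)} → Insert j e Θ Θ′ → lookup Θ′ j ≡ e
Insert-lookup here      = refl
Insert-lookup (there p) = Insert-lookup p

Insert-punchIn : ∀ {j e} {Θ′ : Ctx (suc n)} → Insert j e Θ Θ′ → ∀ i → lookup Θ′ (punchIn j i) ≡ lookup Θ i
Insert-punchIn here      i       = refl
Insert-punchIn (there p) zero    = refl
Insert-punchIn (there p) (suc i) = Insert-punchIn p i

Insert-punchOut : ∀ {j x e} {Θ′ : Ctx (suc n)} → Insert j e Θ Θ′ → (j≢x : j ≢ x) →
                  lookup Θ (punchOut j≢x) ≡ lookup Θ′ x
Insert-punchOut {Θ′ = Θ′} p j≢x =
  trans (sym (Insert-punchIn p (punchOut j≢x))) (cong (lookup Θ′) (punchIn-punchOut j≢x))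

Insert-All : ∀ {P : Entry → Set} {j e} {Θ′ : Ctx (suc n)} → Insert j e Θ Θ′ → Vec.All P Θ′ →
             P e × Vec.All P Θ
Insert-All here      (p ∷ ps) = p , ps
Insert-All (there i) (p ∷ ps) with Insert-All i ps
... | p′ , ps′ = p′ , p ∷ ps′

Insert-⋈ : ∀ {j e} {Θ′ Θ₁′ Θ₂′ : Ctx (suc n)} → Insert j e Θ Θ′ → Θ′ ≔ Θ₁′ ⋈ Θ₂′ →
           Σ (Entry × Entry) λ (e₁ , e₂) → ∃₂ λ Θ₁ Θ₂ →
             Merge e e₁ e₂ × Insert j e₁ Θ₁ Θ₁′ × Insert j e₂ Θ₂ Θ₂′ × Θ ≔ Θ₁ ⋈ Θ₂
Insert-⋈ here      (m ∷ ms) = _ , _ , _ , m , here , here , ms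
Insert-⋈ (there p) (m ∷ ms) with Insert-⋈ p ms
... | _ , _ , _ , m′ , p₁ , p₂ , ms′ = _ , _ , _ , m′ , there p₁ , there p₂ , m ∷ ms′

-- Arg Ψ u e: u, typed in Ψ, may replace a variable declared by the entry e.  An
-- N-typed variable may be shared between premises, so Ψ must then be N-typed too.
data Arg {n} : Ctx n → Tm n → Entry → Set where
  unused : Arg ∅ u nothing
  used   : ∀ {Ψ} → Ψ ⊢ u ∶ X → Vec.All (AspEntry a) Ψ → (X ≡ 𝐍 → Vec.All NatEntry Ψ) →
           Arg Ψ u (just (a , X))

Arg-asp : ∀ {Ψ e} → Arg Ψ u e → AspEntry a e → Vec.All (AspEntry a) Ψ
Arg-asp unused         _           = All-∅ ae-nothing
Arg-asp (used _ asp _) (ae-just p) = Vec.map (AspEntry-mono p) asp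

Arg-nat : ∀ {Ψ e} → Arg Ψ u e → NatEntry e → Vec.All NatEntry Ψ
Arg-nat unused         _       = All-∅ ne-nothing
Arg-nat (used _ _ nat) ne-just = nat refl

Arg-numeral : ∀ {k} → Arg {n} ∅ (numeral k) (just (a , 𝐍))
Arg-numeral = used ty-con (All-∅ ae-nothing) (λ _ → All-∅ ne-nothing)

Arg-weaken : ∀ {Ψ e} → Arg Ψ u e → Arg (nothing ∷ Ψ) (weaken u) e
Arg-weaken unused           = unused
Arg-weaken (used d asp nat) = used (⊢-weaken d) (ae-nothing ∷ asp) (λ eq → ne-nothing ∷ nat eq)

data SubstCtx {n} (j : Fin (suc n)) (u : Tm n) (Θ : Ctx (suc n)) (Ξ : Ctx n) : Set where
  substCtx : ∀ {e Θ⁻ Ψ} → Insert j e Θ⁻ Θ → Arg Ψ u e → Ξ ≔ Θ⁻ ⋈ Ψ → SubstCtx j u Θ Ξ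

SubstCtx-weaken : ∀ {j e} → SubstCtx j u Θ Ξ → SubstCtx (suc j) (weaken u) (e ∷ Θ) (e ∷ Ξ)
SubstCtx-weaken (substCtx p arg ms) = substCtx (there p) (Arg-weaken arg) (merge-identityʳ ∷ ms)

SubstCtx-asp : ∀ {j} → SubstCtx j u Θ Ξ → Vec.All (AspEntry a) Θ → Vec.All (AspEntry a) Ξ
SubstCtx-asp (substCtx p arg ms) asp with Insert-All p asp
... | ae , asp⁻ = ⋈-All ms asp⁻ (Arg-asp arg ae)

SubstCtx-nat : ∀ {j} → SubstCtx j u Θ Ξ → Vec.All NatEntry Θ → Vec.All NatEntry Ξ
SubstCtx-nat (substCtx p arg ms) nes with Insert-All p nes
... | ne , nes⁻ = ⋈-All ms nes⁻ (Arg-nat arg ne)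

private
  SubstCtx-split : ∀ {j e e₁ e₂ Ψ} {Θ⁻ Θ₁⁻ Θ₂⁻ : Ctx n} →
    Merge e e₁ e₂ → Insert j e₁ Θ₁⁻ Θ₁ → Insert j e₂ Θ₂⁻ Θ₂ → Arg Ψ u e → Ξ ≔ Θ⁻ ⋈ Ψ → Θ⁻ ≔ Θ₁⁻ ⋈ Θ₂⁻ →
    ∃₂ λ Ξ₁ Ξ₂ → SubstCtx j u Θ₁ Ξ₁ × SubstCtx j u Θ₂ Ξ₂ × Ξ ≔ Ξ₁ ⋈ Ξ₂
  SubstCtx-split absent p₁ p₂ unused ms ms⁻ with ⋈-distribʳ (All-∅ ne-nothing) ms ms⁻
  ... | _ , _ , ξ₁ , ξ₂ , ξ = _ , _ , substCtx p₁ unused ξ₁ , substCtx p₂ unused ξ₂ , ξ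
  SubstCtx-split onlyˡ p₁ p₂ arg ms ms⁻ with ⋈-rotate ms ms⁻
  ... | _ , ξ₁ , ξ = _ , _ , substCtx p₁ arg ξ₁ , substCtx p₂ unused ⋈-identityʳ , ξ
  SubstCtx-split onlyʳ p₁ p₂ arg ms ms⁻ with ⋈-assoc ms ms⁻
  ... | _ , ξ₂ , ξ = _ , _ , substCtx p₁ unused ⋈-identityʳ , substCtx p₂ arg ξ₂ , ξ
  SubstCtx-split shared p₁ p₂ arg@(used _ _ nat) ms ms⁻ with ⋈-distribʳ (nat refl) ms ms⁻
  ... | _ , _ , ξ₁ , ξ₂ , ξ = _ , _ , substCtx p₁ arg ξ₁ , substCtx p₂ arg ξ₂ , ξ

SubstCtx-⋈ : ∀ {j} → SubstCtx j u Θ Ξ → Θ ≔ Θ₁ ⋈ Θ₂ →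
             ∃₂ λ Ξ₁ Ξ₂ → SubstCtx j u Θ₁ Ξ₁ × SubstCtx j u Θ₂ Ξ₂ × Ξ ≔ Ξ₁ ⋈ Ξ₂
SubstCtx-⋈ (substCtx p arg ms) ms′ with Insert-⋈ p ms′
... | _ , _ , _ , m , p₁ , p₂ , ms⁻ = SubstCtx-split m p₁ p₂ arg ms ms⁻

⊢-subst-var : ∀ {j x} {σ : Fin (suc n) → Tm n} → lookup Θ x ≡ just (a , X) →
              (∀ i → σ (punchIn j i) ≡ var i) → σ j ≡ u → SubstCtx j u Θ Ξ → Ξ ⊢ σ x ∶ X
⊢-subst-var {j = j} {x = x} e σ≗ σj (substCtx p arg ms) with j ≟ x
... | yes refl with ≡.subst (Arg _ _) (trans (sym (Insert-lookup p)) e) arg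
...   | used d _ _ = ≡.subst (_ ⊢_∶ _) (sym σj) (⊢-⊆ d (⋈-⊆ʳ ms))
⊢-subst-var {σ = σ} e σ≗ σj (substCtx p arg ms) | no j≢x =
  ≡.subst (λ y → _ ⊢ σ y ∶ _) (punchIn-punchOut j≢x)
    (≡.subst (_ ⊢_∶ _) (sym (σ≗ _)) (ty-var (⊆-just (⋈-⊆ˡ ms) (trans (Insert-punchOut p j≢x) e))))

⊢-subst : ∀ {j} {σ : Fin (suc n) → Tm n} → Θ ⊢ t ∶ X →
          (∀ i → σ (punchIn j i) ≡ var i) → σ j ≡ u → SubstCtx j u Θ Ξ → Ξ ⊢ subst σ t ∶ X
⊢-subst (ty-var e)   σ≗ σj sc = ⊢-subst-var e σ≗ σj sc
⊢-subst (ty-sub d p) σ≗ σj sc = ty-sub (⊢-subst d σ≗ σj sc) p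
⊢-subst ty-con       σ≗ σj sc = ty-con
⊢-subst {j = j} {σ = σ} (ty-lam d) σ≗ σj sc = ty-lam (⊢-subst d exts-σ≗ (cong weaken σj) (SubstCtx-weaken sc))
  where
  exts-σ≗ : ∀ i → exts σ (punchIn (suc j) i) ≡ var i
  exts-σ≗ zero    = refl
  exts-σ≗ (suc i) = cong weaken (σ≗ i)
⊢-subst (ty-app an q₁ q₂ q q′ d₁ d₂ asp) σ≗ σj sc with SubstCtx-⋈ sc (appSplit⇒⋈ an q₁ q₂ q q′)
... | _ , _ , sc₁ , sc₂ , ξ =
  ⊢-app ξ (⊢-subst d₁ σ≗ σj sc₁) (⊢-subst d₂ σ≗ σj sc₂) (SubstCtx-asp sc₂ (CtxAsp⇒All asp))
⊢-subst (ty-case an q₁ q₂ q₃ q₄ f e d q d₁ d₂ d₃ d₄ bf) σ≗ σj sc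
  with caseMerges⇒chain (caseSplit⇒caseMerges an q₁ q₂ q₃ q₄ f e d q)
... | _ , _ , ms₁ , ms₂ , ms₃ with SubstCtx-⋈ sc ms₁
... | _ , _ , sc₁ , scᴱ , ξ₁ with SubstCtx-⋈ scᴱ ms₂
... | _ , _ , sc₂ , scᶠ , ξ₂ with SubstCtx-⋈ scᶠ ms₃
... | _ , _ , sc₃ , sc₄ , ξ₃ =
  ⊢-case-chain ξ₁ ξ₂ ξ₃ (⊢-subst d₁ σ≗ σj sc₁) (⊢-subst d₂ σ≗ σj sc₂)
                        (⊢-subst d₃ σ≗ σj sc₃) (⊢-subst d₄ σ≗ σj sc₄) bf
⊢-subst (ty-rec a₁ a₂ g t s d q d₁ d₂ d₃ asp bf) σ≗ σj sc
  with recMerges⇒chain (recSplit⇒recMerges a₁ a₂ g t s d q)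
... | nes , _ , ms₁ , ms₂ with SubstCtx-⋈ sc ms₁
... | _ , _ , scᵀ , scᴱ , ξ₁ with SubstCtx-⋈ scᴱ ms₂
... | _ , _ , scˢ , scᴳ , ξ₂ =
  ⊢-rec-chain (SubstCtx-nat scᴳ nes) ξ₁ ξ₂ (⊢-subst d₁ σ≗ σj scᵀ) (⊢-subst d₂ σ≗ σj scˢ)
              (⊢-subst d₃ σ≗ σj scᴳ) (SubstCtx-asp scᵀ (CtxAsp⇒All asp)) bf

⊢-case-branches : Θ ⊢ case X t s r q ∶ Z → Θ ⊢ s ∶ Z × Θ ⊢ r ∶ Z × Θ ⊢ q ∶ Z
⊢-case-branches {Θ = Θ} d with case-inv d
... | caseInv ms _ d₂ d₃ d₄ _ o with caseMerges⇒chain ms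
...   | E , F , ms₁ , ms₂ , ms₃ =
  ty-sub (⊢-⊆ d₂ (⊆-trans (⋈-⊆ˡ ms₂) E⊆Θ)) o ,
  ty-sub (⊢-⊆ d₃ (⊆-trans (⋈-⊆ˡ ms₃) F⊆Θ)) o ,
  ty-sub (⊢-⊆ d₄ (⊆-trans (⋈-⊆ʳ ms₃) F⊆Θ)) o
  where
  E⊆Θ : E ⊆ Θ
  E⊆Θ = ⋈-⊆ʳ ms₁
  F⊆Θ : F ⊆ Θ
  F⊆Θ = ⊆-trans (⋈-⊆ʳ ms₂) E⊆Θ

⊢-recursion-base : Θ ⊢ recursion X t s r ∶ Z → Θ ⊢ s ∶ Z
⊢-recursion-base d with rec-inv d
... | recInv ms _ d₂ _ _ _ o with recMerges⇒chain ms
...   | _ , _ , ms₁ , ms₂ = ty-sub (⊢-⊆ d₂ (⊆-trans (⋈-⊆ˡ ms₂) (⋈-⊆ʳ ms₁))) o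

-- The step function r lives in an N-typed context, so it can share it with the
-- recursive call.
⊢-recursion-unfold : ∀ {k k′} → Θ ⊢ recursion X t s r ∶ Z →
                     Θ ⊢ app (app r (numeral k)) (recursion X (numeral k′) s r) ∶ Z
⊢-recursion-unfold {Θ = Θ} d with rec-inv d
... | recInv ms _ d₂ d₃ asp bf o with recMerges⇒chain ms
...   | nes , _ , ms₁ , ms₂ =
  ty-sub (⊢-app (⋈-absorb nes (⊆-trans (⋈-⊆ʳ ms₂) (⋈-⊆ʳ ms₁)))
                (⊢-app ⋈-identityʳ d₃ ty-con (All-∅ ae-nothing))
                (⊢-rec ms ty-con d₂ d₃ asp bf)
                (Vec.universal AspEntry-■ Θ)) o

⊢-con-numeral : ∀ {c k} → Θ ⊢ con c ∶ Z → typeOf c ≡ 𝐍 → Θ ⊢ numeral k ∶ Z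
⊢-con-numeral d eq = ty-sub ty-con (≡.subst (_<: _) eq (con-inv d))

⊢-app-con-numeral : ∀ {c k} → Θ ⊢ app (con c) s ∶ Z → typeOf c ≡ arr ■ 𝐍 𝐍 → Θ ⊢ numeral k ∶ Z
⊢-app-con-numeral d eq with app-inv d
... | appInv _ d₁ _ _ o with arr-<:-inv (≡.subst (_<: _) eq (con-inv d₁))
...   | _ , 𝐍<:Y , _ = ty-sub ty-con (<:-trans 𝐍<:Y o)

⊢-β-𝐍 : ∀ {k} → Θ ⊢ app (lam a 𝐍 t) (numeral k) ∶ Z → Θ ⊢ t [0≔ numeral k ] ∶ Z
⊢-β-𝐍 d with app-inv d
... | appInv ms d₁ _ _ o with lam-inv d₁
...   | _ , dt , lam<: with arr-<:-inv lam<: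
...     | _ , Y₀<:Y , _ =
  ty-sub (⊢-⊆ (⊢-subst dt (λ _ → refl) refl (substCtx here Arg-numeral ⋈-identityʳ)) (⋈-⊆ˡ ms))
         (<:-trans Y₀<:Y o)

⊢-β-arr : ∀ {X₁ X₂} → Θ ⊢ app (lam a (arr b X₁ X₂) t) s ∶ Z → Θ ⊢ t [0≔ s ] ∶ Z
⊢-β-arr d with app-inv d
... | appInv ms d₁ d₂ asp o with lam-inv d₁
...   | _ , dt , lam<: with arr-<:-inv lam<:
...     | X<:H , Y₀<:Y , a′<:a =
  ty-sub (⊢-subst dt (λ _ → refl) refl
           (substCtx here (used (ty-sub d₂ X<:H) (Vec.map (AspEntry-mono a′<:a) asp) (λ ())) ms))
         (<:-trans Y₀<:Y o)

⊢-perm : Θ ⊢ app (app (lam a X t) s) r ∶ Z → Θ ⊢ app (lam a X (app t (weaken r))) s ∶ Z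
⊢-perm d with app-inv d
... | appInv ms d₁ d₂ asp o with app-inv d₁
...   | appInv ms′ e₁ e₂ asp′ o′ with lam-inv e₁
...     | _ , dt , lam<: with arr-<:-inv lam<: | ⋈-rotate ms ms′
...       | X′<:X , Y₀<:Y , b<:a | _ , ξ₁ , ξ =
  ty-sub (⊢-app ξ (ty-lam (⊢-app (merge-identityʳ ∷ ξ₁) (ty-sub dt (<:-trans Y₀<:Y o′))
                                 (⊢-weaken d₂) (ae-nothing ∷ asp)))
                  (ty-sub e₂ X′<:X) (Vec.map (AspEntry-mono b<:a) asp′)) o

subject-reduction : ∀ {ts} → Θ ⊢ t ∶ Z → t ⟶ ts → All (λ u → Θ ⊢ u ∶ Z) ts
subject-reduction d case-zero = proj₁ (⊢-case-branches d) ∷ []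
subject-reduction d case-even = proj₁ (proj₂ (⊢-case-branches d)) ∷ []
subject-reduction d case-odd  = proj₂ (proj₂ (⊢-case-branches d)) ∷ []
subject-reduction d rec-zero  = ⊢-recursion-base d ∷ []
subject-reduction d rec-suc   = ⊢-recursion-unfold d ∷ []
subject-reduction d s0        = ⊢-app-con-numeral d refl ∷ []
subject-reduction d s1        = ⊢-app-con-numeral d refl ∷ []
subject-reduction d p-zero    = ⊢-app-con-numeral d refl ∷ []
subject-reduction d p-num     = ⊢-app-con-numeral d refl ∷ []
subject-reduction d beta-N    = ⊢-β-𝐍 d ∷ []
subject-reduction d beta-H    = ⊢-β-arr d ∷ []
subject-reduction d perm      = ⊢-perm d ∷ []
subject-reduction d rand      = ⊢-con-numeral d refl ∷ ⊢-con-numeral d refl ∷ []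
subject-reduction d (cong-appˡ st) with app-inv d
... | appInv ms d₁ d₂ asp o = gmap⁺ (λ d′ → ty-sub (⊢-app ms d′ d₂ asp) o) (subject-reduction d₁ st)
subject-reduction d (cong-appʳ st) with app-inv d
... | appInv ms d₁ d₂ asp o = gmap⁺ (λ d′ → ty-sub (⊢-app ms d₁ d′ asp) o) (subject-reduction d₂ st)
subject-reduction d (cong-lam st) with lam-inv d
... | _ , dt , o = gmap⁺ (λ d′ → ty-sub (ty-lam d′) o) (subject-reduction dt st)
subject-reduction d (cong-case₁ st) with case-inv d
... | caseInv ms d₁ d₂ d₃ d₄ bf o = gmap⁺ (λ d′ → ty-sub (⊢-case ms d′ d₂ d₃ d₄ bf) o) (subject-reduction d₁ st)
subject-reduction d (cong-case₂ st) with case-inv d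
... | caseInv ms d₁ d₂ d₃ d₄ bf o = gmap⁺ (λ d′ → ty-sub (⊢-case ms d₁ d′ d₃ d₄ bf) o) (subject-reduction d₂ st)
subject-reduction d (cong-case₃ st) with case-inv d
... | caseInv ms d₁ d₂ d₃ d₄ bf o = gmap⁺ (λ d′ → ty-sub (⊢-case ms d₁ d₂ d′ d₄ bf) o) (subject-reduction d₃ st)
subject-reduction d (cong-case₄ st) with case-inv d
... | caseInv ms d₁ d₂ d₃ d₄ bf o = gmap⁺ (λ d′ → ty-sub (⊢-case ms d₁ d₂ d₃ d′ bf) o) (subject-reduction d₄ st)
subject-reduction d (cong-rec st) with rec-inv d
... | recInv ms d₁ d₂ d₃ asp bf o = gmap⁺ (λ d′ → ty-sub (⊢-rec ms d′ d₂ d₃ asp bf) o) (subject-reduction d₁ st)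

mainTheorem6 : ∀ {n : ℕ} (Γ : Ctx n) (t : Tm n) (A : Ty) (ts : List (Tm n)) →
    Γ ⊢ t ∶ A → t ⟶ ts → All (λ u → Γ ⊢ u ∶ A) ts
mainTheorem6 Γ t A ts = subject-reduction
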